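{- Let $\mathfrak{S}$ be a board with no isolated point and let $g\in\mathscr{F}(\mathfrak{S},\mathbb{Z})$. Then $g\in V(\mathfrak{S},\mathbb{Z})$ if and only if $\tilde g\in V(\mathfrak{S},\mathbb{F}_2)$.
   Context: A board $\mathfrak{S}$ is a finite subset of $\mathbb{Z}^2$. $\mathscr{F}(\mathfrak{S},R)$ denotes functions $\mathfrak{S}\to R$; $[P]$ is the function equal to $1$ at $P$ and $0$ elsewhere. The set of moves $\mathscr{D}(\mathfrak{S})$ consists of all functions $[P]+[Q]-[R]$ with $P,Q,R\in\mathfrak{S}$, $Q=P+v$, $R=P+2v$ for some $v\in\{(\pm1,0),(0,\pm1)\}$; $Q$ is the middle point and $P,R$ the extremities. $V(\mathfrak{S},\mathbb{Z})$ is the $\mathbb{Z}$-span of $\mathscr{D}(\mathfrak{S})$ in $\mathscr{F}(\mathfrak{S},\mathbb{Z})$. For $g\in\mathscr{F}(\mathfrak{S},\mathbb{Z})$, $\tilde g\in\mathscr{F}(\mathfrak{S},\mathbb{F}_2)$ is its reduction modulo $2$, and $V(\mathfrak{S},\mathbb{F}_2)$ is the $\mathbb{F}_2$-span of $\{\tilde{\mathfrak{g}}:\mathfrak{g}\in\mathscr{D}(\mathfrak{S})\}$. Two points are neighbors if they are the two extremities of some move; $\equiv$ is the reflexive-transitive closure of this relation. The board has no isolated point if every $P\in\mathfrak{S}$ is $\equiv$-equivalent to the middle point of some move. -}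

module Defs where

open import Data.Bool using (Bool; true; false; if_then_else_; _xor_; _∧_)
open import Data.Integer using (ℤ; +_; _+_; _-_; _*_; -_; ∣_∣)
import Data.Integer.Properties as ℤP
open import Data.Nat using (ℕ)
open import Data.Nat.DivMod using (_%_)
open import Data.Product using (_×_; _,_; Σ; ∃; ∃-syntax)
open import Data.Product.Properties using (≡-dec)
open import Data.List using (List; []; _∷_; foldr; map)
open import Data.List.Membership.Propositional using (_∈_)
open import Relation.Binary.PropositionalEquality using (_≡_)
open import Relation.Nullary.Decidable using (⌊_⌋)
open import Relation.Binary.Construct.Closure.ReflexiveTransitive using (Star)

Point : Set
Point = ℤ × ℤ

_≟P_ : (P Q : Point) → Relation.Nullary.Decidable.Dec (P ≡ Q)
_≟P_ = ≡-dec Data.Integer._≟_ Data.Integer._≟_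

_⊕_ : Point → Point → Point
(a , b) ⊕ (c , d) = (a + c , b + d)

-- A board: a finite subset of ℤ², given by a list of its points
-- (membership is the only thing that matters).
Board : Set
Board = List Point

-- Functions 𝔖 → R are represented as functions Point → R; only their
-- values on points of 𝔖 are ever used (equalities are checked on 𝔖).
F : Set → Set
F R = Point → R

data Dir : Set where
  east west north south : Dir

vec : Dir → Point
vec east  = (+ 1 , + 0)
vec west  = (- (+ 1) , + 0)
vec north = (+ 0 , + 1)
vec south = (+ 0 , - (+ 1))

-- A (potential) move is determined by its first extremity P and direction v:
-- Q = P + v (middle), R = P + 2v.
record Move : Set where
  constructor mv
  field
    start : Point
    dir   : Dir

open Move public

middle : Move → Point
middle m = start m ⊕ vec (dir m)

endpt : Move → Point
endpt m = middle m ⊕ vec (dir m)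

ValidMove : Board → Move → Set
ValidMove S m = (start m ∈ S) × (middle m ∈ S) × (endpt m ∈ S)

ind : Point → F ℤ
ind P X = if ⌊ X ≟P P ⌋ then + 1 else + 0

moveFun : Move → F ℤ
moveFun m X = (ind (start m) X + ind (middle m) X) - ind (endpt m) X

-- 𝔽₂ is modelled by Bool with addition xor and multiplication ∧
𝔽₂ : Set
𝔽₂ = Bool

red : ℤ → 𝔽₂
red z = if ⌊ (∣ z ∣ % 2) Data.Nat.≟ 0 ⌋ then false else true

reduce : F ℤ → F 𝔽₂
reduce g X = red (g X)

InVℤ : Board → F ℤ → Set
InVℤ S g = ∃[ cs ] ((∀ {c m} → (c , m) ∈ cs → ValidMove S m) ×
  (∀ {X} → X ∈ S → g X ≡ foldr (λ { (c , m) acc → c * moveFun m X + acc }) (+ 0) cs))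

InV𝔽₂ : Board → F 𝔽₂ → Set
InV𝔽₂ S h = ∃[ cs ] ((∀ {c m} → (c , m) ∈ cs → ValidMove S m) ×
  (∀ {X} → X ∈ S → h X ≡ foldr (λ { (c , m) acc → (c ∧ red (moveFun m X)) xor acc }) false cs))

Neighbors : Board → Point → Point → Set
Neighbors S P R = ∃[ m ] (ValidMove S m × (((start m ≡ P) × (endpt m ≡ R)) Data.Sum.⊎ ((start m ≡ R) × (endpt m ≡ P))))
  where import Data.Sum

Equiv : Board → Point → Point → Set
Equiv S = Star (Neighbors S)

NoIsolatedPoint : Board → Set
NoIsolatedPoint S = ∀ {P} → P ∈ S → ∃[ m ] (ValidMove S m × Equiv S P (middle m))

module Submission where

-- Reduction modulo 2 is a ring homomorphism ℤ → 𝔽₂, so reducing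
-- the coefficients of an integer combination of moves gives the direction
-- "g ∈ V(𝔖,ℤ) ⇒ g̃ ∈ V(𝔖,𝔽₂)".  Conversely, lift an 𝔽₂-combination for g̃ to
-- an integer combination with 0/1 coefficients; what remains of g is even on
-- 𝔖, so it suffices to show that 2[P] ∈ V(𝔖,ℤ) for every P ∈ 𝔖.  This holds
-- for a middle point Q of a move m, since m + m⁻¹ = 2[Q] (m⁻¹ the reversed
-- move), and it propagates between neighbors P, R, since m - m⁻¹ = 2[P] - 2[R]
-- for a move m with extremities P and R; with no isolated point every P ∈ 𝔖
-- is reached this way.

open import Defs
open import Function.Bundles using (_⇔_; mk⇔)
open import Function.Base using (id)
open import Data.Bool using (Bool; true; false; _xor_; _∧_; if_then_else_)
open import Data.Bool.Properties using (xor-same)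
open import Data.Integer using (ℤ; +_; -[1+_]; _+_; _-_; _*_; -_; ∣_∣)
import Data.Integer.Properties as ℤP
open import Data.Integer.DivMod using (_%ℕ_; _/ℕ_; n%ℕd<d; a≡a%ℕn+[a/ℕn]*n)
open import Data.Integer.Tactic.RingSolver using (solve-∀)
import Data.Nat as ℕ
open import Data.Nat using (ℕ; s≤s)
import Data.Nat.Properties as ℕP
open import Data.Nat.DivMod using ([m+kn]%n≡m%n)
open import Data.Product using (_×_; _,_; Σ; proj₁; map₁)
open import Data.Sum using (inj₁; inj₂)
open import Data.List using (List; []; _∷_; _++_; foldr; map)
open import Data.List.Membership.Propositional using (_∈_; _∉_)
open import Data.List.Membership.Propositional.Properties using (∈-++⁻; ∈-map⁻)
open import Data.List.Relation.Unary.Any using (here; there)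
open import Relation.Binary.Construct.Closure.ReflexiveTransitive using (ε; _◅_)
open import Relation.Binary.PropositionalEquality
open import Relation.Nullary using (yes; no)
open import Relation.Nullary.Decidable using (⌊_⌋)
open import Data.Empty using (⊥-elim)

bit : Bool → ℤ
bit false = + 0
bit true  = + 1

-- By definition  red z = oddℕ (∣ z ∣ % 2).
oddℕ : ℕ → Bool
oddℕ r = if ⌊ r ℕ.≟ 0 ⌋ then false else true

red-periodic : ∀ r k → red (+ (r ℕ.+ k ℕ.* 2)) ≡ red (+ r)
red-periodic r k = cong oddℕ ([m+kn]%n≡m%n r k 2)

red-neg : ∀ z → red (- z) ≡ red z
red-neg z = cong (λ n → red (+ n)) (ℤP.∣-i∣≡∣i∣ z)

red-2j+b : ∀ j b → red (+ 2 * j + bit b) ≡ b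
red-2j+b j false = begin
  red (+ 2 * j + + 0)    ≡⟨ cong red (ℤP.+-identityʳ (+ 2 * j)) ⟩
  red (+ ∣ + 2 * j ∣)    ≡⟨ cong (λ n → red (+ n)) (trans (ℤP.abs-* (+ 2) j) (ℕP.*-comm 2 ∣ j ∣)) ⟩
  red (+ (∣ j ∣ ℕ.* 2))  ≡⟨ red-periodic 0 ∣ j ∣ ⟩
  false                  ∎
  where open ≡-Reasoning
red-2j+b (+ n) true = begin
  red (+ 2 * + n + + 1)          ≡⟨ cong red (trans (shift (+ n)) (sym (pos-odd n))) ⟩
  red (+ (1 ℕ.+ n ℕ.* 2))        ≡⟨ red-periodic 1 n ⟩
  true                           ∎
  where
  open ≡-Reasoning
  pos-odd : ∀ n → + (1 ℕ.+ n ℕ.* 2) ≡ + 1 + + n * + 2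
  pos-odd n = trans (ℤP.pos-+ 1 (n ℕ.* 2)) (cong (λ t → + 1 + t) (ℤP.pos-* n 2))
  shift : ∀ x → + 2 * x + + 1 ≡ + 1 + x * + 2
  shift = solve-∀
red-2j+b -[1+ n ] true = begin
  red (+ 2 * -[1+ n ] + + 1)     ≡⟨ cong red (reflect (+ n)) ⟩
  red (- (+ 2 * + n + + 1))      ≡⟨ red-neg (+ 2 * + n + + 1) ⟩
  red (+ 2 * + n + + 1)          ≡⟨ red-2j+b (+ n) true ⟩
  true                           ∎
  where
  open ≡-Reasoning
  -- note that -[1+ n ] is - (+ 1 + + n) by definition
  reflect : ∀ x → + 2 * (- (+ 1 + x)) + + 1 ≡ - (+ 2 * x + + 1)
  reflect = solve-∀

-- Rewriting the division identity z = r + q·2 in the form 2q + r.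
remainder-last : ∀ r q → r + q * + 2 ≡ + 2 * q + r
remainder-last = solve-∀

parity-split : ∀ z → Σ ℤ λ j → Σ Bool λ b → z ≡ + 2 * j + bit b
parity-split z with z %ℕ 2 | n%ℕd<d z 2 | a≡a%ℕn+[a/ℕn]*n z 2
... | 0               | _            | e = z /ℕ 2 , false , trans e (remainder-last (+ 0) (z /ℕ 2))
... | 1               | _            | e = z /ℕ 2 , true  , trans e (remainder-last (+ 1) (z /ℕ 2))
... | ℕ.suc (ℕ.suc _) | s≤s (s≤s ()) | _

red-of-split : ∀ {z} j b → z ≡ + 2 * j + bit b → red z ≡ b
red-of-split j b refl = red-2j+b j b

half : ℤ → ℤ
half z = proj₁ (parity-split z)

even⇒double : ∀ z → red z ≡ false → z ≡ + 2 * half z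
even⇒double z even with parity-split z
... | j , false , e = trans e (ℤP.+-identityʳ (+ 2 * j))
... | j , true  , e with () ← trans (sym even) (red-of-split j true e)

bit-+ : ∀ p q → bit p + bit q ≡ + 2 * bit (p ∧ q) + bit (p xor q)
bit-+ false false = refl
bit-+ false true  = refl
bit-+ true  false = refl
bit-+ true  true  = refl

bit-* : ∀ p q → bit p * bit q ≡ bit (p ∧ q)
bit-* false false = refl
bit-* false true  = refl
bit-* true  false = refl
bit-* true  true  = refl

red-bit : ∀ b → red (bit b) ≡ b
red-bit false = refl
red-bit true  = refl

red-+ : ∀ a b → red (a + b) ≡ red a xor red b
red-+ a b with parity-split a | parity-split b
... | j , p , refl | k , q , refl = begin
  red ((+ 2 * j + bit p) + (+ 2 * k + bit q))
    ≡⟨ cong red (regroup j k (bit p) (bit q)) ⟩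
  red (+ 2 * (j + k) + (bit p + bit q))
    ≡⟨ cong (λ t → red (+ 2 * (j + k) + t)) (bit-+ p q) ⟩
  red (+ 2 * (j + k) + (+ 2 * bit (p ∧ q) + bit (p xor q)))
    ≡⟨ red-of-split (j + k + bit (p ∧ q)) (p xor q) (carry (j + k) (bit (p ∧ q)) (bit (p xor q))) ⟩
  p xor q
    ≡⟨ sym (cong₂ _xor_ (red-2j+b j p) (red-2j+b k q)) ⟩
  red (+ 2 * j + bit p) xor red (+ 2 * k + bit q) ∎
  where
  open ≡-Reasoning
  regroup : ∀ j k x y → (+ 2 * j + x) + (+ 2 * k + y) ≡ + 2 * (j + k) + (x + y)
  regroup = solve-∀
  carry : ∀ i c s → + 2 * i + (+ 2 * c + s) ≡ + 2 * (i + c) + s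
  carry = solve-∀

red-* : ∀ a b → red (a * b) ≡ red a ∧ red b
red-* a b with parity-split a | parity-split b
... | j , p , refl | k , q , refl = begin
  red ((+ 2 * j + bit p) * (+ 2 * k + bit q))
    ≡⟨ cong red (expand j k (bit p) (bit q)) ⟩
  red (+ 2 * (+ 2 * j * k + j * bit q + bit p * k) + bit p * bit q)
    ≡⟨ cong (λ t → red (+ 2 * (+ 2 * j * k + j * bit q + bit p * k) + t)) (bit-* p q) ⟩
  red (+ 2 * (+ 2 * j * k + j * bit q + bit p * k) + bit (p ∧ q))
    ≡⟨ red-2j+b (+ 2 * j * k + j * bit q + bit p * k) (p ∧ q) ⟩
  p ∧ q
    ≡⟨ sym (cong₂ _∧_ (red-2j+b j p) (red-2j+b k q)) ⟩
  red (+ 2 * j + bit p) ∧ red (+ 2 * k + bit q) ∎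
  where
  open ≡-Reasoning
  expand : ∀ j k x y → (+ 2 * j + x) * (+ 2 * k + y) ≡ + 2 * (+ 2 * j * k + j * y + x * k) + x * y
  expand = solve-∀

red-- : ∀ a b → red (a - b) ≡ red a xor red b
red-- a b = trans (red-+ a (- b)) (cong (red a xor_) (red-neg b))

Combination : Set → Set
Combination A = List (A × Move)

Valid : ∀ {A} → Board → Combination A → Set
Valid S cs = ∀ {c m} → (c , m) ∈ cs → ValidMove S m

evalℤ : Point → Combination ℤ → ℤ
evalℤ X []             = + 0
evalℤ X ((c , m) ∷ cs) = c * moveFun m X + evalℤ X cs

eval𝔽₂ : Point → Combination 𝔽₂ → 𝔽₂
eval𝔽₂ X []             = false
eval𝔽₂ X ((c , m) ∷ cs) = (c ∧ red (moveFun m X)) xor eval𝔽₂ X cs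

mapCoeff : ∀ {A B} → (A → B) → Combination A → Combination B
mapCoeff f = map (map₁ f)

mapCoeff-valid : ∀ {A B S} (f : A → B) cs → Valid S cs → Valid S (mapCoeff f cs)
mapCoeff-valid f cs valid c,m∈ with ∈-map⁻ (map₁ f) c,m∈
... | _ , c,m∈cs , refl = valid c,m∈cs

++-valid : ∀ {A S} (cs ds : Combination A) → Valid S cs → Valid S ds → Valid S (cs ++ ds)
++-valid cs ds vcs vds c,m∈ with ∈-++⁻ cs c,m∈
... | inj₁ c,m∈cs = vcs c,m∈cs
... | inj₂ c,m∈ds = vds c,m∈ds

evalℤ-++ : ∀ X cs ds → evalℤ X (cs ++ ds) ≡ evalℤ X cs + evalℤ X ds
evalℤ-++ X []             ds = sym (ℤP.+-identityˡ (evalℤ X ds))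
evalℤ-++ X ((c , m) ∷ cs) ds = begin
  c * moveFun m X + evalℤ X (cs ++ ds)               ≡⟨ cong (_+_ (c * moveFun m X)) (evalℤ-++ X cs ds) ⟩
  c * moveFun m X + (evalℤ X cs + evalℤ X ds)        ≡⟨ ℤP.+-assoc (c * moveFun m X) (evalℤ X cs) (evalℤ X ds) ⟨
  c * moveFun m X + evalℤ X cs + evalℤ X ds          ∎
  where open ≡-Reasoning

evalℤ-scale : ∀ X k cs → evalℤ X (mapCoeff (k *_) cs) ≡ k * evalℤ X cs
evalℤ-scale X k []             = sym (ℤP.*-zeroʳ k)
evalℤ-scale X k ((c , m) ∷ cs) = begin
  k * c * moveFun m X + evalℤ X (mapCoeff (k *_) cs) ≡⟨ cong (_+_ (k * c * moveFun m X)) (evalℤ-scale X k cs) ⟩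
  k * c * moveFun m X + k * evalℤ X cs               ≡⟨ distrib k c (moveFun m X) (evalℤ X cs) ⟩
  k * (c * moveFun m X + evalℤ X cs)                 ∎
  where
  open ≡-Reasoning
  distrib : ∀ k c a r → k * c * a + k * r ≡ k * (c * a + r)
  distrib = solve-∀

-- The definitions InVℤ, InV𝔽₂ evaluate a combination by a right fold with an
-- anonymous step function; any such fold agrees with evalℤ / eval𝔽₂.
foldr-evalℤ : ∀ {f : ℤ × Move → ℤ → ℤ} X → (∀ c m acc → f (c , m) acc ≡ c * moveFun m X + acc) →
              ∀ cs → foldr f (+ 0) cs ≡ evalℤ X cs
foldr-evalℤ X step []             = refl
foldr-evalℤ X step ((c , m) ∷ cs) = trans (step c m _) (cong (_+_ (c * moveFun m X)) (foldr-evalℤ X step cs))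

foldr-eval𝔽₂ : ∀ {f : 𝔽₂ × Move → 𝔽₂ → 𝔽₂} X → (∀ c m acc → f (c , m) acc ≡ (c ∧ red (moveFun m X)) xor acc) →
               ∀ cs → foldr f false cs ≡ eval𝔽₂ X cs
foldr-eval𝔽₂ X step []             = refl
foldr-eval𝔽₂ X step ((c , m) ∷ cs) = trans (step c m _) (cong ((c ∧ red (moveFun m X)) xor_) (foldr-eval𝔽₂ X step cs))

Spanℤ : Board → F ℤ → Set
Spanℤ S f = Σ (Combination ℤ) λ cs → Valid S cs × (∀ {X} → X ∈ S → f X ≡ evalℤ X cs)

Span𝔽₂ : Board → F 𝔽₂ → Set
Span𝔽₂ S h = Σ (Combination 𝔽₂) λ cs → Valid S cs × (∀ {X} → X ∈ S → h X ≡ eval𝔽₂ X cs)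

InVℤ→Spanℤ : ∀ {S g} → InVℤ S g → Spanℤ S g
InVℤ→Spanℤ (cs , valid , eq) = cs , valid , λ {X} X∈S → trans (eq X∈S) (foldr-evalℤ X (λ _ _ _ → refl) cs)

Spanℤ→InVℤ : ∀ {S g} → Spanℤ S g → InVℤ S g
Spanℤ→InVℤ (cs , valid , eq) = cs , valid , λ {X} X∈S → trans (eq X∈S) (sym (foldr-evalℤ X (λ _ _ _ → refl) cs))

InV𝔽₂→Span𝔽₂ : ∀ {S h} → InV𝔽₂ S h → Span𝔽₂ S h
InV𝔽₂→Span𝔽₂ (cs , valid , eq) = cs , valid , λ {X} X∈S → trans (eq X∈S) (foldr-eval𝔽₂ X (λ _ _ _ → refl) cs)

Span𝔽₂→InV𝔽₂ : ∀ {S h} → Span𝔽₂ S h → InV𝔽₂ S h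
Span𝔽₂→InV𝔽₂ (cs , valid , eq) = cs , valid , λ {X} X∈S → trans (eq X∈S) (sym (foldr-eval𝔽₂ X (λ _ _ _ → refl) cs))

Spanℤ-ext : ∀ {S f g} → (∀ {X} → X ∈ S → f X ≡ g X) → Spanℤ S g → Spanℤ S f
Spanℤ-ext f≗g (cs , valid , eq) = cs , valid , λ X∈S → trans (f≗g X∈S) (eq X∈S)

Spanℤ-zero : ∀ {S} → Spanℤ S (λ _ → + 0)
Spanℤ-zero = [] , (λ ()) , λ _ → refl

Spanℤ-+ : ∀ {S f g} → Spanℤ S f → Spanℤ S g → Spanℤ S (λ X → f X + g X)
Spanℤ-+ (cs , vcs , eqf) (ds , vds , eqg) =
  cs ++ ds , ++-valid cs ds vcs vds ,
  λ {X} X∈S → trans (cong₂ _+_ (eqf X∈S) (eqg X∈S)) (sym (evalℤ-++ X cs ds))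

Spanℤ-scale : ∀ {S f} k → Spanℤ S f → Spanℤ S (λ X → k * f X)
Spanℤ-scale k (cs , valid , eq) =
  mapCoeff (k *_) cs , mapCoeff-valid (k *_) cs valid ,
  λ {X} X∈S → trans (cong (k *_) (eq X∈S)) (sym (evalℤ-scale X k cs))

opposite : Dir → Dir
opposite east  = west
opposite west  = east
opposite north = south
opposite south = north

neg : Point → Point
neg (x , y) = (- x , - y)

vec-opposite : ∀ d → vec (opposite d) ≡ neg (vec d)
vec-opposite east  = refl
vec-opposite west  = refl
vec-opposite north = refl
vec-opposite south = refl

⊕-neg : ∀ P v → (P ⊕ v) ⊕ neg v ≡ P
⊕-neg (a , b) (x , y) = cong₂ _,_ (cancel a x) (cancel b y)
  where
  cancel : ∀ a x → (a + x) + (- x) ≡ a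
  cancel = solve-∀

reverse : Move → Move
reverse m = mv (endpt m) (opposite (dir m))

middle-reverse : ∀ m → middle (reverse m) ≡ middle m
middle-reverse m = begin
  endpt m ⊕ vec (opposite (dir m))  ≡⟨ cong (endpt m ⊕_) (vec-opposite (dir m)) ⟩
  endpt m ⊕ neg (vec (dir m))       ≡⟨ ⊕-neg (middle m) (vec (dir m)) ⟩
  middle m                          ∎
  where open ≡-Reasoning

endpt-reverse : ∀ m → endpt (reverse m) ≡ start m
endpt-reverse m = begin
  middle (reverse m) ⊕ vec (opposite (dir m))  ≡⟨ cong₂ _⊕_ (middle-reverse m) (vec-opposite (dir m)) ⟩
  middle m ⊕ neg (vec (dir m))                 ≡⟨ ⊕-neg (start m) (vec (dir m)) ⟩
  start m                                      ∎
  where open ≡-Reasoning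

reverse-valid : ∀ {S} m → ValidMove S m → ValidMove S (reverse m)
reverse-valid {S} m (P∈S , Q∈S , R∈S) =
  R∈S , subst (_∈ S) (sym (middle-reverse m)) Q∈S , subst (_∈ S) (sym (endpt-reverse m)) P∈S

moveFun-reverse : ∀ m X → moveFun (reverse m) X ≡ (ind (endpt m) X + ind (middle m) X) - ind (start m) X
moveFun-reverse m X = cong₂ (λ Q P → (ind (endpt m) X + ind Q X) - ind P X) (middle-reverse m) (endpt-reverse m)

two-middle : ∀ {S} m → ValidMove S m → Spanℤ S (λ X → + 2 * ind (middle m) X)
two-middle {S} m valid = (+ 1 , m) ∷ (+ 1 , reverse m) ∷ [] , pair-valid , λ {X} _ →
  trans (sum (ind (start m) X) (ind (middle m) X) (ind (endpt m) X))
        (cong (λ t → + 1 * moveFun m X + (+ 1 * t + + 0)) (sym (moveFun-reverse m X)))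
  where
  sum : ∀ p q r → + 2 * q ≡ + 1 * ((p + q) - r) + (+ 1 * ((r + q) - p) + + 0)
  sum = solve-∀
  pair-valid : Valid S ((+ 1 , m) ∷ (+ 1 , reverse m) ∷ [])
  pair-valid (here refl)         = valid
  pair-valid (there (here refl)) = reverse-valid m valid

two-extremities : ∀ {S} m → ValidMove S m → Spanℤ S (λ X → + 2 * ind (start m) X - + 2 * ind (endpt m) X)
two-extremities {S} m valid = (+ 1 , m) ∷ (- + 1 , reverse m) ∷ [] , pair-valid , λ {X} _ →
  trans (difference (ind (start m) X) (ind (middle m) X) (ind (endpt m) X))
        (cong (λ t → + 1 * moveFun m X + (- + 1 * t + + 0)) (sym (moveFun-reverse m X)))
  where
  difference : ∀ p q r → + 2 * p - + 2 * r ≡ + 1 * ((p + q) - r) + (- + 1 * ((r + q) - p) + + 0)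
  difference = solve-∀
  pair-valid : Valid S ((+ 1 , m) ∷ (- + 1 , reverse m) ∷ [])
  pair-valid (here refl)         = valid
  pair-valid (there (here refl)) = reverse-valid m valid

two-neighbors : ∀ {S P R} → Neighbors S P R → Spanℤ S (λ X → + 2 * ind P X - + 2 * ind R X)
two-neighbors (m , valid , inj₁ (refl , refl)) = two-extremities m valid
two-neighbors {S} (m , valid , inj₂ (refl , refl)) =
  subst (λ P → Spanℤ S (λ X → + 2 * ind (endpt m) X - + 2 * ind P X))
        (endpt-reverse m) (two-extremities (reverse m) (reverse-valid m valid))

two-equiv : ∀ {S P R} → Equiv S P R → Spanℤ S (λ X → + 2 * ind R X) → Spanℤ S (λ X → + 2 * ind P X)
two-equiv ε                     twoR = twoR
two-equiv {P = P} (nb ◅ chain) twoR =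
  Spanℤ-ext (λ {X} _ → recombine (+ 2 * ind P X) _)
            (Spanℤ-+ (two-neighbors nb) (two-equiv chain twoR))
  where
  recombine : ∀ a b → a ≡ (a - b) + b
  recombine = solve-∀

two-point : ∀ {S P} → NoIsolatedPoint S → P ∈ S → Spanℤ S (λ X → + 2 * ind P X)
two-point noIsolated P∈S with noIsolated P∈S
... | m , valid , P≡Q = two-equiv P≡Q (two-middle m valid)

-- 2e ∈ V(𝔖,ℤ) whenever e vanishes on 𝔖 outside a list L ⊆ 𝔖 of points:
-- by induction on L, splitting off e(P)·[P] for the head P of L.
two-multiple-supported : ∀ {S} → NoIsolatedPoint S → ∀ L → (∀ {P} → P ∈ L → P ∈ S) →
  ∀ e → (∀ {X} → X ∈ S → X ∉ L → e X ≡ + 0) → Spanℤ S (λ X → + 2 * e X)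
two-multiple-supported noIsolated [] L⊆S e vanish =
  Spanℤ-ext (λ X∈S → cong (+ 2 *_) (vanish X∈S λ ())) Spanℤ-zero
two-multiple-supported {S} noIsolated (P ∷ L) L⊆S e vanish =
  Spanℤ-ext (λ {X} _ → split (e X) (e P) (ind P X))
            (Spanℤ-+ (Spanℤ-scale (e P) (two-point noIsolated (L⊆S (here refl))))
                     (two-multiple-supported noIsolated L (λ P∈L → L⊆S (there P∈L)) rest rest-vanishes))
  where
  split : ∀ a b i → + 2 * a ≡ b * (+ 2 * i) + + 2 * (a - b * i)
  split = solve-∀
  rest : F ℤ
  rest X = e X - e P * ind P X
  rest-vanishes : ∀ {X} → X ∈ S → X ∉ L → rest X ≡ + 0
  -- deciding X ≟ P also evaluates the indicator ind P X in the goal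
  rest-vanishes {X} X∈S X∉L with X ≟P P
  ... | yes refl = cancel (e X)
    where
    cancel : ∀ a → a - a * + 1 ≡ + 0
    cancel = solve-∀
  ... | no X≢P = trans (drop (e X) (e P)) (vanish X∈S X∉P∷L)
    where
    drop : ∀ a b → a - b * + 0 ≡ a
    drop = solve-∀
    X∉P∷L : X ∉ P ∷ L
    X∉P∷L (here X≡P)  = X≢P X≡P
    X∉P∷L (there X∈L) = X∉L X∈L

even-in-span : ∀ {S} → NoIsolatedPoint S → ∀ d → (∀ {X} → X ∈ S → red (d X) ≡ false) → Spanℤ S d
even-in-span {S} noIsolated d even =
  Spanℤ-ext (λ {X} X∈S → even⇒double (d X) (even X∈S))
            (two-multiple-supported noIsolated S id (λ X → half (d X)) (λ X∈S X∉S → ⊥-elim (X∉S X∈S)))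

red-evalℤ : ∀ X cs → red (evalℤ X cs) ≡ eval𝔽₂ X (mapCoeff red cs)
red-evalℤ X []             = refl
red-evalℤ X ((c , m) ∷ cs) =
  trans (red-+ (c * moveFun m X) (evalℤ X cs))
        (cong₂ _xor_ (red-* c (moveFun m X)) (red-evalℤ X cs))

red-evalℤ-lift : ∀ X cs → red (evalℤ X (mapCoeff bit cs)) ≡ eval𝔽₂ X cs
red-evalℤ-lift X cs = begin
  red (evalℤ X (mapCoeff bit cs))           ≡⟨ red-evalℤ X (mapCoeff bit cs) ⟩
  eval𝔽₂ X (mapCoeff red (mapCoeff bit cs)) ≡⟨ cong (eval𝔽₂ X) (lift-reduce cs) ⟩
  eval𝔽₂ X cs                               ∎
  where
  open ≡-Reasoning
  lift-reduce : ∀ cs → mapCoeff red (mapCoeff bit cs) ≡ cs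
  lift-reduce []             = refl
  lift-reduce ((c , m) ∷ cs) = cong₂ (λ c cs → (c , m) ∷ cs) (red-bit c) (lift-reduce cs)

reduce-span : ∀ {S g} → Spanℤ S g → Span𝔽₂ S (reduce g)
reduce-span (cs , valid , eq) =
  mapCoeff red cs , mapCoeff-valid red cs valid ,
  λ {X} X∈S → trans (cong red (eq X∈S)) (red-evalℤ X cs)

-- g̃ ∈ V(𝔖,𝔽₂) ⇒ g ∈ V(𝔖,ℤ): g minus the lift of an 𝔽₂-combination for g̃ is even on 𝔖.
lift-span : ∀ {S g} → NoIsolatedPoint S → Span𝔽₂ S (reduce g) → Spanℤ S g
lift-span {S} {g} noIsolated (cs , valid , eq) =
  Spanℤ-ext (λ {X} _ → recombine (g X) (evalℤ X lift))
            (Spanℤ-+ lift-in-span (even-in-span noIsolated difference difference-even))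
  where
  recombine : ∀ a b → a ≡ b + (a - b)
  recombine = solve-∀
  lift : Combination ℤ
  lift = mapCoeff bit cs
  lift-in-span : Spanℤ S (λ X → evalℤ X lift)
  lift-in-span = lift , mapCoeff-valid bit cs valid , λ _ → refl
  difference : F ℤ
  difference X = g X - evalℤ X lift
  difference-even : ∀ {X} → X ∈ S → red (difference X) ≡ false
  difference-even {X} X∈S = begin
    red (g X - evalℤ X lift)            ≡⟨ red-- (g X) (evalℤ X lift) ⟩
    red (g X) xor red (evalℤ X lift)    ≡⟨ cong₂ _xor_ (eq X∈S) (red-evalℤ-lift X cs) ⟩
    eval𝔽₂ X cs xor eval𝔽₂ X cs         ≡⟨ xor-same (eval𝔽₂ X cs) ⟩
    false                               ∎
    where open ≡-Reasoning

theorem2 : (S : Board) → NoIsolatedPoint S → (g : F ℤ) → InVℤ S g ⇔ InV𝔽₂ S (reduce g)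
theorem2 S noIsolated g = mk⇔
  (λ g∈V → Span𝔽₂→InV𝔽₂ (reduce-span (InVℤ→Spanℤ g∈V)))
  (λ g̃∈V → Spanℤ→InVℤ (lift-span noIsolated (InV𝔽₂→Span𝔽₂ g̃∈V)))
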